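{- Let $A$ be a finite alphabet, $k>1$, and let $\phi'$ be a sentence of $FO^2[<,\mathrm{bet}]$ over the alphabet $(A\cup\{*\})^k$. Then there is a sentence $\phi$ of $FO^2[<,\mathrm{betfac}]$ over $A$ such that for every $w\in A^+$ with $|w|\ge k-1$: $w\models\phi$ if and only if $w''\models\phi'$.
   Context: $*$ is a new symbol not in $A$. The set $(A\cup\{*\})^k$ of words of length $k$ is treated as a finite alphabet. For $w\in A^+$, $w''$ is the word over $(A\cup\{*\})^k$ whose letters are the successive length-$k$ factors of $*^{k-1}w$, read left to right (so $|w''|=|w|$). $FO^2[<,\mathrm{bet}]$ over an alphabet $C$: two-variable first-order logic (two reusable variables) with $<$, unary predicates $c(x)$ and binary predicates $c(x,y)$ ($c\in C$) meaning some position strictly between $x$ and $y$ carries $c$. $FO^2[<,\mathrm{betfac}]$ over $A$: two-variable first-order logic with $<$, unary letter predicates and binary predicates $\langle u\rangle(x,y)$ ($u\in A^+$) meaning some occurrence of the factor $u$ lies strictly between $x$ and $y$ (positions $z,\dots,z+|u|-1$ with $x<z$, $z+|u|-1<y$ spelling $u$). -}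

module Defs where

open import Data.Nat using (ℕ; zero; suc; _+_; _<_; _≤_)
open import Data.Fin using (Fin; toℕ)
open import Data.Bool using (Bool; true; false; T)
open import Data.Maybe using (Maybe; just; nothing)
open import Data.List using (List; []; _∷_; _++_; length; lookup; replicate; map; take; drop)
open import Data.List.NonEmpty using (List⁺; toList)
open import Data.Vec using (Vec)
import Data.Vec as V
open import Data.Product using (Σ; _×_; ∃)
open import Data.Unit using (⊤)
open import Data.Empty using (⊥)
open import Relation.Binary.PropositionalEquality using (_≡_)
open import Relation.Nullary using (¬_)

-- They are indexed by the
-- scope Γ : Var → Bool telling which of the two variables are bound, so
-- that sentences are exactly the formulas of empty scope.

data Var : Set where
  vx vy : Var

Scope : Set
Scope = Var → Bool

bind : Scope → Var → Scope
bind Γ vx vx = true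
bind Γ vx vy = Γ vy
bind Γ vy vx = Γ vx
bind Γ vy vy = true

data Fm (C B : Set) : Scope → Set where
  true′ : ∀ {Γ} → Fm C B Γ
  _<′_  : ∀ {Γ} (u v : Var) {{_ : T (Γ u)}} {{_ : T (Γ v)}} → Fm C B Γ
  _=′_  : ∀ {Γ} (u v : Var) {{_ : T (Γ u)}} {{_ : T (Γ v)}} → Fm C B Γ
  letter : ∀ {Γ} (c : C) (v : Var) {{_ : T (Γ v)}} → Fm C B Γ
  binary : ∀ {Γ} (b : B) (u v : Var) {{_ : T (Γ u)}} {{_ : T (Γ v)}} → Fm C B Γ
  ¬′_   : ∀ {Γ} → Fm C B Γ → Fm C B Γ
  _∧′_  : ∀ {Γ} → Fm C B Γ → Fm C B Γ → Fm C B Γ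
  ∃′    : ∀ {Γ} (v : Var) → Fm C B (bind Γ v) → Fm C B Γ

Sentence : Set → Set → Set
Sentence C B = Fm C B (λ _ → false)

Env : ∀ {C : Set} → List C → Scope → Set
Env w Γ = (v : Var) → T (Γ v) → Fin (length w)

update : ∀ {C : Set} (w : List C) {Γ} → Env w Γ → (v : Var) → Fin (length w) → Env w (bind Γ v)
update w ρ vx i vx _ = i
update w ρ vx i vy p = ρ vy p
update w ρ vy i vx p = ρ vx p
update w ρ vy i vy _ = i

BinInterp : Set → Set → Set₁
BinInterp C B = B → (w : List C) → Fin (length w) → Fin (length w) → Set

⟦_⟧ : ∀ {C B : Set} {Γ} → Fm C B Γ → BinInterp C B → (w : List C) → Env w Γ → Set
⟦ true′ ⟧ I w ρ = ⊤
⟦ _<′_ u v {{p}} {{q}} ⟧ I w ρ = toℕ (ρ u p) < toℕ (ρ v q)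
⟦ _=′_ u v {{p}} {{q}} ⟧ I w ρ = ρ u p ≡ ρ v q
⟦ letter c v {{p}} ⟧ I w ρ = lookup w (ρ v p) ≡ c
⟦ binary b u v {{p}} {{q}} ⟧ I w ρ = I b w (ρ u p) (ρ v q)
⟦ ¬′ φ ⟧ I w ρ = ¬ ⟦ φ ⟧ I w ρ
⟦ φ ∧′ ψ ⟧ I w ρ = ⟦ φ ⟧ I w ρ × ⟦ ψ ⟧ I w ρ
⟦ ∃′ v φ ⟧ I w ρ = Σ (Fin (length w)) λ i → ⟦ φ ⟧ I w (update w ρ v i)

emptyEnv : ∀ {C : Set} (w : List C) → Env w (λ _ → false)
emptyEnv w v ()

_⊨[_]_ : ∀ {C B : Set} → List C → BinInterp C B → Sentence C B → Set
w ⊨[ I ] φ = ⟦ φ ⟧ I w (emptyEnv w)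

bet : ∀ {C : Set} → BinInterp C C
bet c w i j = Σ (Fin (length w)) λ z → (toℕ i < toℕ z) × (toℕ z < toℕ j) × (lookup w z ≡ c)

FO2bet : Set → Set
FO2bet C = Sentence C C

betfac : ∀ {A : Set} → BinInterp A (List⁺ A)
betfac u w i j =
  Σ ℕ λ z → (toℕ i < z) × (z + length (toList u) ≤ toℕ j)
           × (take (length (toList u)) (drop z w) ≡ toList u)

FO2betfac : Set → Set
FO2betfac A = Sentence A (List⁺ A)

-- The word w'' : letters are the successive length-k factors of *^{k-1} w.
-- A ∪ {*} is represented as Maybe A (nothing = *).

takeVec : ∀ {X : Set} (k : ℕ) → List X → Maybe (Vec X k)
takeVec zero l = just V.[]
takeVec (suc k) [] = nothing
takeVec (suc k) (x ∷ l) with takeVec k l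
... | just v = just (x V.∷ v)
... | nothing = nothing

maybeToList : ∀ {X : Set} → Maybe X → List X
maybeToList (just x) = x ∷ []
maybeToList nothing = []

factors : ∀ {X : Set} (k : ℕ) → List X → List (Vec X k)
factors k [] = maybeToList (takeVec k [])
factors k (x ∷ l) = maybeToList (takeVec k (x ∷ l)) ++ factors k l

Ext : Set → ℕ → Set
Ext A k = Vec (Maybe A) k

_″ : ∀ {A : Set} {k : ℕ} → List A → List (Ext A k)
_″ {A} {zero} w = factors zero (map just w)
_″ {A} {suc k} w = factors (suc k) (replicate k nothing ++ map just w)

-- Position z of w″ carries the window of *^(k-1) w ending at z. So c(x) says that c, read
-- leftwards from x, is spelled by w padded with stars beyond its left end; FO²[<,betfac] expresses
-- this by walking from x to its predecessors, the successor relation being x < y with no one-letter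
-- factor strictly between. For c(x,y), look at where the window of a witness z ∈ (x,y) starts. If it
-- starts after x, c is a word u over A and the condition is ⟨u⟩(x,y). Otherwise c = P S with P
-- ending at x (expressed as before), S starting at x+1 (walking rightwards) and S ending before y,
-- which, S occurring at x+1, is ⟨S⟩(x,y). The disjunction over all splittings of c expresses c(x,y).

module Submission where

open import Defs
open import Data.Bool using (T)
open import Data.Empty using (⊥; ⊥-elim)
open import Data.Fin as Fin using (Fin; toℕ; fromℕ<; cast)
open import Data.Fin.Properties using (toℕ<n; toℕ-fromℕ<; toℕ-injective; toℕ-cast; any?)
open import Data.List using (List; []; _∷_; _++_; [_]; length; lookup; take; drop; replicate; reverse; map; allFin)
open import Data.List.Properties
  using (∷-injective; take-[]; length-replicate; length-map; length-++; length-reverse; reverse-++; unfold-reverse;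
         reverse-involutive; reverse-injective; reverse-map)
open import Data.List.NonEmpty using (List⁺; _∷_; toList)
open import Data.List.Relation.Unary.All using (All; []; _∷_)
open import Data.List.Relation.Unary.Any using (Any; here; there)
open import Data.List.Membership.Propositional using (_∈_; find; lose)
open import Data.List.Membership.Propositional.Properties using (∈-map⁺; ∈-map⁻; ∈-allFin)
open import Data.List.Relation.Unary.Any.Properties using (map⁺; map⁻)
open import Data.Maybe using (Maybe; just; nothing)
import Data.Maybe as Maybe
open import Data.Maybe.Properties using (just-injective)
import Data.Maybe.Properties as Maybeₚ
open import Data.Nat using (ℕ; zero; suc; _+_; _∸_; _<_; _≤_; z≤n; s≤s; z<s)
open import Data.Nat.Properties
open import Data.Product using (Σ; ∃; ∃₂; _×_; _,_; proj₁; proj₂; map₁)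
open import Data.Product.Function.NonDependent.Propositional using (_×-⇔_)
open import Data.Sum using (inj₁; inj₂)
open import Data.Unit using (⊤; tt)
open import Data.Vec as Vec using (Vec)
import Data.Vec.Properties as Vec
open import Function.Base using (_∘_; id)
open import Function.Bundles using (_⇔_; mk⇔; Equivalence)
open import Function.Related.Propositional using (module EquationalReasoning; equivalence)
open import Function.Properties.Equivalence using () renaming (trans to ⇔-trans; sym to ⇔-sym)
open import Function.Related.TypeIsomorphisms using (¬-cong-⇔)
open import Relation.Nullary using (¬_; Dec; yes; no)
open import Relation.Nullary.Negation using (¬¬-map)
open import Relation.Nullary.Decidable using (_×-dec_; decidable-stable)
open import Relation.Binary.PropositionalEquality hiding ([_])

open Equivalence using (to; from)

private variable
  X Y : Set

at : List X → ℕ → Maybe X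
at []      _       = nothing
at (x ∷ l) zero    = just x
at (x ∷ l) (suc p) = at l p

at-lookup : (l : List X) (i : Fin (length l)) → at l (toℕ i) ≡ just (lookup l i)
at-lookup (x ∷ l) Fin.zero    = refl
at-lookup (x ∷ l) (Fin.suc i) = at-lookup l i

at≡just⇒< : (l : List X) (p : ℕ) {a : X} → at l p ≡ just a → p < length l
at≡just⇒< (x ∷ l) zero    _  = s≤s z≤n
at≡just⇒< (x ∷ l) (suc p) eq = s≤s (at≡just⇒< l p eq)

<⇒at≡just : (l : List X) (p : ℕ) → p < length l → ∃ λ a → at l p ≡ just a
<⇒at≡just (x ∷ l) zero    _         = x , refl
<⇒at≡just (x ∷ l) (suc p) (s≤s p<l) = <⇒at≡just l p p<l

at-++ʳ : (xs ys : List X) (p : ℕ) → at (xs ++ ys) (length xs + p) ≡ at ys p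
at-++ʳ []       ys p = refl
at-++ʳ (x ∷ xs) ys p = at-++ʳ xs ys p

at-map : (f : X → Y) (l : List X) (p : ℕ) → at (map f l) p ≡ Maybe.map f (at l p)
at-map f []      p       = refl
at-map f (x ∷ l) zero    = refl
at-map f (x ∷ l) (suc p) = at-map f l p

take-suc-at : (p : ℕ) (l : List X) → take (suc p) l ≡ take p l ++ maybeToList (at l p)
take-suc-at zero    []      = refl
take-suc-at (suc p) []      = refl
take-suc-at zero    (x ∷ l) = refl
take-suc-at (suc p) (x ∷ l) = cong (x ∷_) (take-suc-at p l)

take-+ : (m n : ℕ) (l : List X) → take (m + n) l ≡ take m l ++ take n (drop m l)
take-+ zero    n l       = refl
take-+ (suc m) n []      = sym (take-[] n)
take-+ (suc m) n (x ∷ l) = cong (x ∷_) (take-+ m n l)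

take-length-++ : (xs ys : List X) → take (length xs) (xs ++ ys) ≡ xs
take-length-++ []       ys = refl
take-length-++ (x ∷ xs) ys = cong (x ∷_) (take-length-++ xs ys)

length-take-drop : (m s : ℕ) (l : List X) → s + m ≤ length l → length (take m (drop s l)) ≡ m
length-take-drop zero    s       l       _          = refl
length-take-drop (suc m) zero    (x ∷ l) (s≤s m≤l)  = cong suc (length-take-drop m 0 l m≤l)
length-take-drop (suc m) (suc s) (x ∷ l) (s≤s sm≤l) = length-take-drop (suc m) s l sm≤l

replicate-∷ʳ : (m : ℕ) (x : X) → replicate m x ++ [ x ] ≡ x ∷ replicate m x
replicate-∷ʳ zero    x = refl
replicate-∷ʳ (suc m) x = cong (x ∷_) (replicate-∷ʳ m x)

reverse-replicate : (m : ℕ) (x : X) → reverse (replicate m x) ≡ replicate m x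
reverse-replicate zero    x = refl
reverse-replicate (suc m) x = begin
  reverse (x ∷ replicate m x)      ≡⟨ unfold-reverse x (replicate m x) ⟩
  reverse (replicate m x) ++ [ x ] ≡⟨ cong (_++ [ x ]) (reverse-replicate m x) ⟩
  replicate m x ++ [ x ]           ≡⟨ replicate-∷ʳ m x ⟩
  x ∷ replicate m x                ∎
  where open ≡-Reasoning

∷-≡⇔ : {x y : X} {xs ys : List X} {P : Set} → P ⇔ (xs ≡ ys) → (x ≡ y × P) ⇔ (x ∷ xs ≡ y ∷ ys)
∷-≡⇔ P⇔ = mk⇔
  (λ { (refl , p) → cong (_ ∷_) (to P⇔ p) })
  (λ eq → proj₁ (∷-injective eq) , from P⇔ (proj₂ (∷-injective eq)))

All≡⇔take-replicate : (m : ℕ) (x : X) (L : List X) → length L ≤ m →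
  All (_≡ x) L ⇔ (take (length L) (replicate m x) ≡ L)
All≡⇔take-replicate m       x []      _         = mk⇔ (λ _ → refl) (λ _ → [])
All≡⇔take-replicate (suc m) x (a ∷ L) (s≤s L≤m) = mk⇔
  (λ { (refl ∷ all) → cong (a ∷_) (to ih all) })
  (λ eq → sym (proj₁ (∷-injective eq)) ∷ from ih (proj₂ (∷-injective eq)))
  where ih = All≡⇔take-replicate m x L L≤m

splits : List X → List (List X × List X)
splits []      = ([] , []) ∷ []
splits (a ∷ L) = ([] , a ∷ L) ∷ map (map₁ (a ∷_)) (splits L)

∈-splits⁺ : (P R : List X) → (P , R) ∈ splits (P ++ R)
∈-splits⁺ []      []      = here refl
∈-splits⁺ []      (b ∷ R) = here refl
∈-splits⁺ (a ∷ P) R       = there (∈-map⁺ (map₁ (a ∷_)) (∈-splits⁺ P R))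

∈-splits⁻ : (L : List X) {P R : List X} → (P , R) ∈ splits L → P ++ R ≡ L
∈-splits⁻ []      (here refl) = refl
∈-splits⁻ (a ∷ L) (here refl) = refl
∈-splits⁻ (a ∷ L) (there mem) with ∈-map⁻ (map₁ (a ∷_)) mem
... | _ , mem′ , refl = cong (a ∷_) (∈-splits⁻ L mem′)

justs : List (Maybe X) → Maybe (List X)
justs []            = just []
justs (nothing ∷ R) = nothing
justs (just a ∷ R)  = Maybe.map (a ∷_) (justs R)

justs-map-just : (S : List X) → justs (map just S) ≡ just S
justs-map-just []      = refl
justs-map-just (a ∷ S) = cong (Maybe.map (a ∷_)) (justs-map-just S)

justs-of : {R : List (Maybe X)} {S : List X} → R ≡ map just S → justs R ≡ just S
justs-of {S = S} refl = justs-map-just S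

justs≡just⇒ : (R : List (Maybe X)) {S : List X} → justs R ≡ just S → R ≡ map just S
justs≡just⇒ []            refl = refl
justs≡just⇒ (just a ∷ R)  eq   with justs R in e
justs≡just⇒ (just a ∷ R)  refl | just S = cong (just a ∷_) (justs≡just⇒ R e)

OccursAt : List X → ℕ → List X → Set
OccursAt l s []      = ⊤
OccursAt l s (a ∷ S) = at l s ≡ just a × OccursAt l (suc s) S

OccursAt-∷ : (x : X) (l : List X) (s : ℕ) (S : List X) → OccursAt (x ∷ l) (suc s) S ≡ OccursAt l s S
OccursAt-∷ x l s []      = refl
OccursAt-∷ x l s (a ∷ S) = cong (at l s ≡ just a ×_) (OccursAt-∷ x l (suc s) S)

OccursAt⇔take-drop : (l : List X) (s : ℕ) (S : List X) → OccursAt l s S ⇔ (take (length S) (drop s l) ≡ S)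
OccursAt⇔take-drop l       s       []      = mk⇔ (λ _ → refl) (λ _ → tt)
OccursAt⇔take-drop []      zero    (a ∷ S) = mk⇔ (λ { (() , _) }) (λ ())
OccursAt⇔take-drop []      (suc s) (a ∷ S) = mk⇔ (λ { (() , _) }) (λ ())
OccursAt⇔take-drop (x ∷ l) zero    (a ∷ S) rewrite OccursAt-∷ x l 0 S = mk⇔
  (λ { (refl , occ) → cong (x ∷_) (to ih occ) })
  (λ eq → cong just (proj₁ (∷-injective eq)) , from ih (proj₂ (∷-injective eq)))
  where ih = OccursAt⇔take-drop l 0 S
OccursAt⇔take-drop (x ∷ l) (suc s) (a ∷ S) rewrite OccursAt-∷ x l s (a ∷ S) = OccursAt⇔take-drop l s (a ∷ S)

OccursAt-∷ʳ : (l : List X) (s : ℕ) (S : List X) (a : X) →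
  OccursAt l s (S ++ [ a ]) ⇔ (OccursAt l s S × at l (length S + s) ≡ just a)
OccursAt-∷ʳ l s []      a = mk⇔ (λ { (eq , _) → tt , eq }) (λ { (_ , eq) → eq , tt })
OccursAt-∷ʳ l s (b ∷ S) a rewrite sym (+-suc (length S) s) = mk⇔
  (λ { (eq , occ) → let occ′ , last = to ih occ in (eq , occ′) , last })
  (λ { ((eq , occ′) , last) → eq , from ih (occ′ , last) })
  where ih = OccursAt-∷ʳ l (suc s) S a

takeVec≡just⇒ : (m : ℕ) (l : List X) (v : Vec X m) → takeVec m l ≡ just v → Vec.toList v ≡ take m l
takeVec≡just⇒ zero    l       Vec.[] _ = refl
takeVec≡just⇒ (suc m) (x ∷ l) v      eq with takeVec m l in e
takeVec≡just⇒ (suc m) (x ∷ l) _      refl | just u = cong (x ∷_) (takeVec≡just⇒ m l u e)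

takeVec-≤ : (m : ℕ) (l : List X) → m ≤ length l → ∃ λ v → takeVec m l ≡ just v
takeVec-≤ zero    l       _         = Vec.[] , refl
takeVec-≤ (suc m) (x ∷ l) (s≤s m≤l) with takeVec m l | takeVec-≤ m l m≤l
... | just u  | _      = x Vec.∷ u , refl
... | nothing | _ , ()

takeVec-> : (m : ℕ) (l : List X) → length l < m → takeVec m l ≡ nothing
takeVec-> (suc m) []      _         = refl
takeVec-> (suc m) (x ∷ l) (s≤s l<m) rewrite takeVec-> m l l<m = refl

takeVec≡nothing⇒ : (m : ℕ) (l : List X) → takeVec m l ≡ nothing → length l < m
takeVec≡nothing⇒ m l e with m ≤? length l
... | no m≰l  = ≰⇒> m≰l
... | yes m≤l with takeVec-≤ m l m≤l
...   | _ , e′ with () ← trans (sym e′) e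

factors-short : (k : ℕ) (l : List X) → length l ≤ k → factors (suc k) l ≡ []
factors-short k []      _   = refl
factors-short k (x ∷ l) l≤k rewrite takeVec-> (suc k) (x ∷ l) (s≤s l≤k) = factors-short k l (<⇒≤ l≤k)

length-factors : (k : ℕ) (l : List X) → length (factors (suc k) l) ≡ length l ∸ k
length-factors k []      = sym (0∸n≡0 k)
length-factors k (x ∷ l) with k ≤? length l
... | yes k≤l with takeVec-≤ (suc k) (x ∷ l) (s≤s k≤l)
...   | v , e rewrite e = trans (cong suc (length-factors k l)) (sym (+-∸-assoc 1 k≤l))
length-factors k (x ∷ l) | no k≰l rewrite factors-short k (x ∷ l) (≰⇒> k≰l) = sym (m≤n⇒m∸n≡0 (≰⇒> k≰l))

lookup-factors : (k : ℕ) (l : List X) (i : Fin (length (factors (suc k) l))) →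
  Vec.toList (lookup (factors (suc k) l) i) ≡ take (suc k) (drop (toℕ i) l)
lookup-factors k (x ∷ l) i with takeVec (suc k) (x ∷ l) in e
lookup-factors k (x ∷ l) Fin.zero    | just v  = takeVec≡just⇒ (suc k) (x ∷ l) v e
lookup-factors k (x ∷ l) (Fin.suc i) | just v  = lookup-factors k l i
lookup-factors k (x ∷ l) i           | nothing
  with () ← subst (Fin ∘ length) (factors-short k l (<⇒≤ (≤-pred (takeVec≡nothing⇒ (suc k) (x ∷ l) e)))) i

module _ {A : Set} (w : List A) where

  -- L is spelled leftwards from position p of *^ω w, with nothing standing for *. Only meaningful
  -- for p < length w: beyond w, at returns nothing just like a star.
  mutual
    BackMatch : ℕ → List (Maybe A) → Set
    BackMatch p []      = ⊤
    BackMatch p (a ∷ L) = at w p ≡ a × BackMatchBefore p L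

    BackMatchBefore : ℕ → List (Maybe A) → Set
    BackMatchBefore zero    L = All (_≡ nothing) L
    BackMatchBefore (suc p) L = BackMatch p L

  BackMatch-justs-++ : (x : ℕ) (T : List A) (Q : List (Maybe A)) →
    BackMatch (length T + x) (map just T ++ Q) ⇔ (OccursAt w (suc x) (reverse T) × BackMatch x Q)
  BackMatch-justs-++ x []      Q = mk⇔ (tt ,_) proj₂
  BackMatch-justs-++ x (t ∷ T) Q rewrite unfold-reverse t T = mk⇔
    (λ { (last , bm) → let occ , bmQ = to ih bm in from snoc (occ , subst (λ i → at w i ≡ just t) (sym position) last) , bmQ })
    (λ { (occ , bmQ) → let occ′ , last = to snoc occ in subst (λ i → at w i ≡ just t) position last , from ih (occ′ , bmQ) })
    where
    ih = BackMatch-justs-++ x T Q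
    snoc = OccursAt-∷ʳ w (suc x) (reverse T) t
    position : length (reverse T) + suc x ≡ suc (length T + x)
    position = trans (cong (_+ suc x) (length-reverse T)) (+-suc (length T) x)

  BackMatch-reverse-++ : (x : ℕ) (P : List (Maybe A)) (S : List A) →
    BackMatch (length S + x) (reverse (P ++ map just S)) ⇔ (OccursAt w (suc x) S × BackMatch x (reverse P))
  BackMatch-reverse-++ x P S = begin
    BackMatch (length S + x) (reverse (P ++ map just S))
      ≡⟨ cong₂ BackMatch (cong (_+ x) (sym (length-reverse S))) reversed ⟩
    BackMatch (length (reverse S) + x) (map just (reverse S) ++ reverse P)
      ∼⟨ BackMatch-justs-++ x (reverse S) (reverse P) ⟩
    (OccursAt w (suc x) (reverse (reverse S)) × BackMatch x (reverse P))
      ≡⟨ cong (λ S′ → OccursAt w (suc x) S′ × BackMatch x (reverse P)) (reverse-involutive S) ⟩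
    (OccursAt w (suc x) S × BackMatch x (reverse P)) ∎
    where
    open EquationalReasoning {k = equivalence}
    reversed : reverse (P ++ map just S) ≡ map just (reverse S) ++ reverse P
    reversed = trans (reverse-++ P (map just S)) (cong (_++ reverse P) (sym (reverse-map just S)))

  length-++-map-just : {L P : List (Maybe A)} {S : List A} → L ≡ P ++ map just S → length L ≡ length P + length S
  length-++-map-just {P = P} {S} refl = trans (length-++ P) (cong (length P +_) (length-map just S))

  BackMatch-justs : (R : List (Maybe A)) (m x : ℕ) → m ≤ length R → m + x < length w →
    BackMatch (m + x) R → ∃₂ λ T Q → R ≡ map just T ++ Q × length T ≡ m
  BackMatch-justs R       zero    x _         _    _          = [] , R , refl , refl
  BackMatch-justs (a ∷ R) (suc m) x (s≤s m≤R) fits (a≡ , bm) with <⇒at≡just w (suc (m + x)) fits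
  ... | b , b≡ with BackMatch-justs R m x m≤R (<-trans (n<1+n _) fits) bm
  ...   | T , Q , R≡ , |T| = b ∷ T , Q , cong₂ _∷_ (trans (sym a≡) b≡) R≡ , cong suc |T|

  BackMatch-suffix : (L : List (Maybe A)) (m x : ℕ) → m ≤ length L → m + x < length w →
    BackMatch (m + x) (reverse L) →
    ∃₂ λ P S → L ≡ P ++ map just S × length S ≡ m × OccursAt w (suc x) S × BackMatch x (reverse P)
  BackMatch-suffix L m x m≤L fits bm
    with BackMatch-justs (reverse L) m x (subst (m ≤_) (sym (length-reverse L)) m≤L) fits bm
  ... | T , Q , rL≡ , |T| = reverse Q , reverse T , L≡ , |S| , to (BackMatch-reverse-++ x (reverse Q) (reverse T)) bm′
    where
    open ≡-Reasoning
    L≡ : L ≡ reverse Q ++ map just (reverse T)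
    L≡ = begin
      L                                   ≡⟨ reverse-involutive L ⟨
      reverse (reverse L)                 ≡⟨ cong reverse rL≡ ⟩
      reverse (map just T ++ Q)           ≡⟨ reverse-++ (map just T) Q ⟩
      reverse Q ++ reverse (map just T)   ≡⟨ cong (reverse Q ++_) (reverse-map just T) ⟨
      reverse Q ++ map just (reverse T)   ∎
    |S| : length (reverse T) ≡ m
    |S| = trans (length-reverse T) |T|
    bm′ : BackMatch (length (reverse T) + x) (reverse (reverse Q ++ map just (reverse T)))
    bm′ = subst₂ BackMatch (cong (_+ x) (sym |S|)) (cong reverse L≡) bm

  OccursBetween : List A → ℕ → ℕ → Set
  OccursBetween S x y = ∃ λ s → x < s × s + length S ≤ y × OccursAt w s S

  -- The window P ++ S has P at or before x (P empty: the window lies entirely after x).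
  Inside : List (Maybe A) → List⁺ A → ℕ → ℕ → Set
  Inside []      S x y = OccursBetween (toList S) x y
  Inside (a ∷ P) S x y = BackMatch x (reverse (a ∷ P)) × OccursAt w (suc x) (toList S) × OccursBetween (toList S) x y

  Between : List (Maybe A) → ℕ → ℕ → Set
  Between R x y = ∃ λ z → x < z × z < y × BackMatch z R

  occurrence⇒Between : (P : List (Maybe A)) (S : List⁺ A) {x y : ℕ} (s : ℕ) → x ≤ s →
    suc s + length (toList S) ≤ y → OccursAt w (suc s) (toList S) → BackMatch s (reverse P) →
    Between (reverse (P ++ map just (toList S))) x y
  occurrence⇒Between P (b ∷ S) {x} {y} s x≤s fit occ bmP =
    length (b ∷ S) + s , s≤s (m≤n⇒m≤o+n (length S) x≤s) , ends-before-y ,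
    from (BackMatch-reverse-++ s P (b ∷ S)) (occ , bmP)
    where
    ends-before-y : length (b ∷ S) + s < y
    ends-before-y = subst (_≤ y) (cong suc (+-comm s (length (b ∷ S)))) fit

  Inside⇒Between : (P : List (Maybe A)) (S : List⁺ A) {x y : ℕ} → Inside P S x y →
    Between (reverse (P ++ map just (toList S))) x y
  Inside⇒Between [] S (suc s , x<s , fit , occ) = occurrence⇒Between [] S s (≤-pred x<s) fit occ tt
  Inside⇒Between (a ∷ P) S {x} (bmP , occ , s , x<s , fit , _) =
    occurrence⇒Between (a ∷ P) S x ≤-refl (≤-trans (+-monoˡ-≤ (length (toList S)) x<s) fit) occ bmP

  Between⇒Inside-overlapping : (L : List (Maybe A)) (x y o : ℕ) → suc o ≤ length L → suc o + x < y → y < length w →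
    BackMatch (suc o + x) (reverse L) → ∃₂ λ P S → L ≡ P ++ map just (toList S) × Inside P S x y
  Between⇒Inside-overlapping L x y o d≤L z<y y<w bm with BackMatch-suffix L (suc o) x d≤L (<-trans z<y y<w) bm
  ... | P , [] , _ , () , _
  ... | P , b ∷ S , L≡ , |S| , occ , bmP = P , b ∷ S , L≡ , inside P bmP
    where
    fit : suc x + length (b ∷ S) ≤ y
    fit = subst (_≤ y) (cong suc (trans (+-comm (suc o) x) (cong (x +_) (sym |S|)))) z<y
    inside : ∀ P → BackMatch x (reverse P) → Inside P (b ∷ S) x y
    inside []      _   = suc x , ≤-refl , fit , occ
    inside (a ∷ P) bmP = bmP , occ , suc x , ≤-refl , fit , occ

  Between⇒Inside-disjoint : (L : List (Maybe A)) (x y r : ℕ) → 0 < length L → length L + (r + x) < y → y < length w →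
    BackMatch (length L + (r + x)) (reverse L) → ∃₂ λ P S → L ≡ P ++ map just (toList S) × Inside P S x y
  Between⇒Inside-disjoint L x y r L≢[] z<y y<w bm with BackMatch-suffix L (length L) (r + x) ≤-refl (<-trans z<y y<w) bm
  ... | [] , [] , _ , |S| , _ = ⊥-elim (<-irrefl |S| L≢[])
  ... | [] , b ∷ S , L≡ , |S| , occ , _ = [] , b ∷ S , L≡ , suc (r + x) , s≤s (m≤n+m x r) , fit , occ
    where
    fit : suc (r + x) + length (b ∷ S) ≤ y
    fit = subst (_≤ y) (cong suc (trans (+-comm (length L) (r + x)) (cong ((r + x) +_) (sym |S|)))) z<y
  ... | a ∷ P , S , L≡ , |S| , _ = ⊥-elim (<-irrefl L≡P+L (m<n+m (length L) z<s))
    where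
    L≡P+L : length L ≡ suc (length P) + length L
    L≡P+L = trans (length-++-map-just {P = a ∷ P} {S} L≡) (cong (suc (length P) +_) |S|)

  Between⇒Inside : (L : List (Maybe A)) (x y : ℕ) → 0 < length L → y < length w → Between (reverse L) x y →
    ∃₂ λ P S → L ≡ P ++ map just (toList S) × Inside P S x y
  Between⇒Inside L x y L≢[] y<w (z , x<z , z<y , bm) with m≤n⇒∃[o]m+o≡n x<z
  ... | o , refl with suc o ≤? length L
  ...   | yes d≤L = Between⇒Inside-overlapping L x y o d≤L (subst (_< y) z≡ z<y) y<w (subst (λ i → BackMatch i (reverse L)) z≡ bm)
    where
    z≡ : suc x + o ≡ suc o + x
    z≡ = cong suc (+-comm x o)
  ...   | no d≰L with m≤n⇒∃[o]m+o≡n (<⇒≤ (≰⇒> d≰L))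
  ...     | r , L+r≡ = Between⇒Inside-disjoint L x y r L≢[] (subst (_< y) z≡ z<y) y<w (subst (λ i → BackMatch i (reverse L)) z≡ bm)
    where
    open ≡-Reasoning
    z≡ : suc x + o ≡ length L + (r + x)
    z≡ = begin
      suc (x + o)         ≡⟨ cong suc (+-comm x o) ⟩
      suc o + x           ≡⟨ cong (_+ x) L+r≡ ⟨
      length L + r + x    ≡⟨ +-assoc (length L) r x ⟩
      length L + (r + x)  ∎

-- Windows have length suc k, and position z of w″ is the window of padded ending at z + k.
module Padded {A : Set} (k : ℕ) (w : List A) where

  padded : List (Maybe A)
  padded = replicate k nothing ++ map just w

  w″ : List (Ext A (suc k))
  w″ = _″ {k = suc k} w

  past : ℕ → List (Maybe A)
  past zero    = at w 0 ∷ replicate k nothing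
  past (suc p) = at w (suc p) ∷ past p

  BackMatch⇔prefix-past : (p : ℕ) (L : List (Maybe A)) → length L ≤ suc k →
    BackMatch w p L ⇔ (take (length L) (past p) ≡ L)
  BackMatch⇔prefix-past p       []      _         = mk⇔ (λ _ → refl) (λ _ → tt)
  BackMatch⇔prefix-past zero    (a ∷ L) (s≤s L≤k) = ∷-≡⇔ (All≡⇔take-replicate k nothing L L≤k)
  BackMatch⇔prefix-past (suc p) (a ∷ L) (s≤s L≤k) = ∷-≡⇔ (BackMatch⇔prefix-past p L (m≤n⇒m≤1+n L≤k))

  length-padded : length padded ≡ k + length w
  length-padded = trans (length-++ (replicate k nothing)) (cong₂ _+_ (length-replicate k) (length-map just w))

  length-w″ : length w″ ≡ length w
  length-w″ = trans (length-factors k padded) (trans (cong (_∸ k) length-padded) (m+n∸m≡n k (length w)))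

  at-padded : (p : ℕ) → p < length w → at padded (k + p) ≡ just (at w p)
  at-padded p p<w with <⇒at≡just w p p<w
  ... | a , e = begin
    at padded (k + p)                             ≡⟨ cong (λ m → at padded (m + p)) (sym (length-replicate k)) ⟩
    at padded (length (replicate k nothing) + p)  ≡⟨ at-++ʳ (replicate k nothing) (map just w) p ⟩
    at (map just w) p                             ≡⟨ at-map just w p ⟩
    Maybe.map just (at w p)                       ≡⟨ cong (Maybe.map just) e ⟩
    just (just a)                                 ≡⟨ cong just (sym e) ⟩
    just (at w p)                                 ∎
    where open ≡-Reasoning

  reverse-take-padded-suc : (p : ℕ) → p < length w →
    reverse (take (suc p + k) padded) ≡ at w p ∷ reverse (take (p + k) padded)
  reverse-take-padded-suc p p<w = begin
    reverse (take (suc (p + k)) padded)                               ≡⟨ cong reverse (take-suc-at (p + k) padded) ⟩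
    reverse (take (p + k) padded ++ maybeToList (at padded (p + k)))  ≡⟨ cong (λ m → reverse (take (p + k) padded ++ maybeToList m)) at-p ⟩
    reverse (take (p + k) padded ++ [ at w p ])                       ≡⟨ reverse-++ (take (p + k) padded) [ at w p ] ⟩
    at w p ∷ reverse (take (p + k) padded)                            ∎
    where
    open ≡-Reasoning
    at-p : at padded (p + k) ≡ just (at w p)
    at-p = trans (cong (at padded) (+-comm p k)) (at-padded p p<w)

  reverse-take-padded : (p : ℕ) → p < length w → reverse (take (suc p + k) padded) ≡ past p
  reverse-take-padded zero    p<w = begin
    reverse (take (suc k) padded)          ≡⟨ reverse-take-padded-suc 0 p<w ⟩
    at w 0 ∷ reverse (take k padded)       ≡⟨ cong (λ l → at w 0 ∷ reverse l) stars ⟩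
    at w 0 ∷ reverse (replicate k nothing) ≡⟨ cong (at w 0 ∷_) (reverse-replicate k nothing) ⟩
    past 0                                 ∎
    where
    open ≡-Reasoning
    stars : take k padded ≡ replicate k nothing
    stars = trans (cong (λ m → take m padded) (sym (length-replicate k))) (take-length-++ (replicate k nothing) (map just w))
  reverse-take-padded (suc p) p<w = trans (reverse-take-padded-suc (suc p) p<w)
    (cong (at w (suc p) ∷_) (reverse-take-padded p (<-trans (n<1+n p) p<w)))

  window-fits : (p : ℕ) → p < length w → p + suc k ≤ length padded
  window-fits p p<w = begin
    p + suc k       ≡⟨ +-suc p k ⟩
    suc p + k       ≤⟨ +-monoˡ-≤ k p<w ⟩
    length w + k    ≡⟨ +-comm (length w) k ⟩
    k + length w    ≡⟨ length-padded ⟨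
    length padded   ∎
    where open ≤-Reasoning

  reverse-window : (p : ℕ) → p < length w → reverse (take (suc k) (drop p padded)) ≡ take (suc k) (past p)
  reverse-window p p<w = begin
    window                                                    ≡⟨ sym (take-length-++ window (reverse (take p padded))) ⟩
    take (length window) (window ++ reverse (take p padded))  ≡⟨ cong₂ take length-window (sym (reverse-++ (take p padded) _)) ⟩
    take (suc k) (reverse (take p padded ++ take (suc k) (drop p padded)))
                                                              ≡⟨ cong (take (suc k) ∘ reverse) (sym (take-+ p (suc k) padded)) ⟩
    take (suc k) (reverse (take (p + suc k) padded))          ≡⟨ cong (λ m → take (suc k) (reverse (take m padded))) (+-suc p k) ⟩
    take (suc k) (reverse (take (suc p + k) padded))          ≡⟨ cong (take (suc k)) (reverse-take-padded p p<w) ⟩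
    take (suc k) (past p)                                     ∎
    where
    open ≡-Reasoning
    window = reverse (take (suc k) (drop p padded))
    length-window : length window ≡ suc k
    length-window = trans (length-reverse (take (suc k) (drop p padded))) (length-take-drop (suc k) p padded (window-fits p p<w))

  lookup-w″≡⇔BackMatch : (z : Fin (length w″)) (c : Ext A (suc k)) →
    (lookup w″ z ≡ c) ⇔ BackMatch w (toℕ z) (reverse (Vec.toList c))
  lookup-w″≡⇔BackMatch z c = mk⇔
    (λ eq → from prefix (begin
      take (length L) (past p)                 ≡⟨ cong (λ m → take m (past p)) length-L ⟩
      take (suc k) (past p)                    ≡⟨ reverse-window p p<w ⟨
      reverse (take (suc k) (drop p padded))   ≡⟨ cong reverse (lookup-factors k padded z) ⟨
      reverse (Vec.toList (lookup w″ z))       ≡⟨ cong (reverse ∘ Vec.toList) eq ⟩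
      L                                        ∎))
    (λ bm → trans (sym (Vec.cast-is-id refl _)) (Vec.toList-injective refl _ _ (reverse-injective (begin
      reverse (Vec.toList (lookup w″ z))       ≡⟨ cong reverse (lookup-factors k padded z) ⟩
      reverse (take (suc k) (drop p padded))   ≡⟨ reverse-window p p<w ⟩
      take (suc k) (past p)                    ≡⟨ cong (λ m → take m (past p)) length-L ⟨
      take (length L) (past p)                 ≡⟨ to prefix bm ⟩
      L                                        ∎))))
    where
    open ≡-Reasoning
    p = toℕ z
    p<w : p < length w
    p<w = subst (p <_) length-w″ (toℕ<n z)
    L = reverse (Vec.toList c)
    length-L : length L ≡ suc k
    length-L = trans (length-reverse (Vec.toList c)) (Vec.length-toList c)
    prefix = BackMatch⇔prefix-past p L (≤-reflexive length-L)

  bet⇔Between : (c : Ext A (suc k)) (i j : Fin (length w″)) →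
    bet c w″ i j ⇔ Between w (reverse (Vec.toList c)) (toℕ i) (toℕ j)
  bet⇔Between c i j = mk⇔
    (λ { (z , i<z , z<j , z≡c) → toℕ z , i<z , z<j , to (lookup-w″≡⇔BackMatch z c) z≡c })
    (λ { (z , i<z , z<j , bm) → let z<w″ = <-trans z<j (toℕ<n j) ; z≡ = toℕ-fromℕ< z<w″ in
           fromℕ< z<w″ , subst (toℕ i <_) (sym z≡) i<z , subst (_< toℕ j) (sym z≡) z<j ,
           from (lookup-w″≡⇔BackMatch (fromℕ< z<w″) c) (subst (λ m → BackMatch w m (reverse (Vec.toList c))) (sym z≡) bm) })

module _ {C B : Set} where

  ⊥′ : ∀ {Γ} → Fm C B Γ
  ⊥′ = ¬′ true′

  ⋁ : ∀ {Γ} → List (Fm C B Γ) → Fm C B Γ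
  ⋁ []       = ⊥′
  ⋁ (φ ∷ φs) = ¬′ ((¬′ φ) ∧′ (¬′ ⋁ φs))

  ⋁-sem : ∀ {Γ} (I : BinInterp C B) (u : List C) (ρ : Env u Γ) (φs : List (Fm C B Γ)) →
    ⟦ ⋁ φs ⟧ I u ρ ⇔ (¬ ¬ Any (λ φ → ⟦ φ ⟧ I u ρ) φs)
  ⋁-sem I u ρ []       = mk⇔ (λ ¬⊤ _ → ¬⊤ tt) (λ ¬¬none _ → ¬¬none λ ())
  ⋁-sem I u ρ (φ ∷ φs) = mk⇔
    (λ ¬both ¬any → ¬both ((λ sat → ¬any (here sat)) , (λ sat → to ih sat (¬any ∘ there))))
    (λ ¬¬any (¬sat , ¬rest) → ¬¬any λ { (here sat) → ¬sat sat ; (there any) → ¬rest (from ih (λ ¬any → ¬any any)) })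
    where ih = ⋁-sem I u ρ φs

other : Var → Var
other vx = vy
other vy = vx

keep : ∀ {Γ} v → T (Γ v) → T (bind Γ (other v) v)
keep vx p = p
keep vy p = p

new : ∀ {Γ} v → T (bind Γ v v)
new vx = tt
new vy = tt

module _ {C : Set} (u : List C) where

  update-new : ∀ {Γ} (ρ : Env u Γ) v i → update u ρ v i v (new v) ≡ i
  update-new ρ vx i = refl
  update-new ρ vy i = refl

  update-keep : ∀ {Γ} (ρ : Env u Γ) v (p : T (Γ v)) i → update u ρ (other v) i v (keep v p) ≡ ρ v p
  update-keep ρ vx p i = refl
  update-keep ρ vy p i = refl

module _ {C B : Set} where

  first′ : ∀ {Γ} v → T (Γ v) → Fm C B Γ
  first′ v p = ¬′ ∃′ (other v) (_<′_ (other v) v {{new (other v)}} {{keep v p}})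

  first′-sem : ∀ {Γ} (I : BinInterp C B) (u : List C) (ρ : Env u Γ) v (p : T (Γ v)) →
    ⟦ first′ v p ⟧ I u ρ ⇔ (toℕ (ρ v p) ≡ 0)
  first′-sem I u ρ v p = mk⇔ ⇒ ⇐
    where
    position : ∀ i → ⟦ _<′_ (other v) v {{new (other v)}} {{keep v p}} ⟧ I u (update u ρ (other v) i) ≡ (toℕ i < toℕ (ρ v p))
    position i = cong₂ (λ a b → toℕ a < toℕ b) (update-new u ρ (other v) i) (update-keep u ρ v p i)
    ⇒ : ⟦ first′ v p ⟧ I u ρ → toℕ (ρ v p) ≡ 0
    ⇒ none with toℕ (ρ v p) in eq
    ... | zero  = refl
    ... | suc _ = ⊥-elim (none (origin , subst id (sym (position origin)) (subst₂ _<_ (sym toℕ-origin) (sym eq) z<s)))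
      where
      u≢[] : 0 < length u
      u≢[] = ≤-<-trans z≤n (toℕ<n (ρ v p))
      origin = fromℕ< u≢[]
      toℕ-origin : toℕ origin ≡ 0
      toℕ-origin = toℕ-fromℕ< u≢[]
    ⇐ : toℕ (ρ v p) ≡ 0 → ⟦ first′ v p ⟧ I u ρ
    ⇐ eq (i , i<v) = <⇒≱ (subst (toℕ i <_) eq (subst id (position i) i<v)) z≤n

module Formulas (n : ℕ) where

  private
    A : Set
    A = Fin n

  F : Scope → Set
  F = Fm A (List⁺ A)

  isLetter′ : ∀ {Γ} → Maybe A → (v : Var) → T (Γ v) → F Γ
  isLetter′ nothing  v p = ⊥′
  isLetter′ (just a) v p = letter a v {{p}}

  succ′ : ∀ {Γ} u v → T (Γ u) → T (Γ v) → F Γ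
  succ′ u v p q = _<′_ u v {{p}} {{q}} ∧′ (¬′ ⋁ (map (λ a → binary (a ∷ []) u v {{p}} {{q}}) (allFin n)))

  next′ : ∀ {Γ} v → T (Γ v) → F (bind Γ (other v)) → F Γ
  next′ v p φ = ∃′ (other v) (succ′ v (other v) (keep v p) (new (other v)) ∧′ φ)

  prev′ : ∀ {Γ} v → T (Γ v) → F (bind Γ (other v)) → F Γ
  prev′ v p φ = ∃′ (other v) (succ′ (other v) v (new (other v)) (keep v p) ∧′ φ)

  occursAfter′ : ∀ {Γ} → List A → (v : Var) → T (Γ v) → F Γ
  occursAfter′ []      v p = true′
  occursAfter′ (a ∷ S) v p = next′ v p (isLetter′ (just a) (other v) (new (other v)) ∧′ occursAfter′ S (other v) (new (other v)))

  allStars′ : ∀ {Γ} → List (Maybe A) → F Γ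
  allStars′ []            = true′
  allStars′ (nothing ∷ L) = allStars′ L
  allStars′ (just _ ∷ L)  = ⊥′

  mutual
    backMatch′ : ∀ {Γ} → List (Maybe A) → (v : Var) → T (Γ v) → F Γ
    backMatch′ []      v p = true′
    backMatch′ (a ∷ L) v p = isLetter′ a v p ∧′ backMatchBefore′ L v p

    backMatchBefore′ : ∀ {Γ} → List (Maybe A) → (v : Var) → T (Γ v) → F Γ
    backMatchBefore′ []            v p = true′
    backMatchBefore′ (nothing ∷ L) v p = first′ v p ∧′ allStars′ L
    backMatchBefore′ (just a ∷ L)  v p = prev′ v p (backMatch′ (just a ∷ L) (other v) (new (other v)))

  inside′ : ∀ {Γ} → List (Maybe A) → List⁺ A → ∀ u v → T (Γ u) → T (Γ v) → F Γ
  inside′ []      S u v p q = binary S u v {{p}} {{q}}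
  inside′ (a ∷ P) S u v p q =
    backMatch′ (reverse (a ∷ P)) u p ∧′ (occursAfter′ (toList S) u p ∧′ binary S u v {{p}} {{q}})

  piece′ : ∀ {Γ} u v → T (Γ u) → T (Γ v) → List (Maybe A) × List (Maybe A) → F Γ
  piece′ u v p q (P , R) with justs R
  ... | just (s ∷ S) = inside′ P (s ∷ S) u v p q
  ... | _            = ⊥′

  between′ : ∀ {Γ} → List (Maybe A) → ∀ u v → T (Γ u) → T (Γ v) → F Γ
  between′ L u v p q = ⋁ (map (piece′ u v p q) (splits L))

  module Semantics (w : List A) where

    Sat : ∀ {Γ} → F Γ → Env w Γ → Set
    Sat φ ρ = ⟦ φ ⟧ betfac w ρ

    pos : ∀ {Γ} → Env w Γ → (v : Var) → T (Γ v) → ℕ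
    pos ρ v p = toℕ (ρ v p)

    pos-new : ∀ {Γ} (ρ : Env w Γ) v i → pos (update w ρ v i) v (new v) ≡ toℕ i
    pos-new ρ v i = cong toℕ (update-new w ρ v i)

    pos-keep : ∀ {Γ} (ρ : Env w Γ) v p i → pos (update w ρ (other v) i) v (keep v p) ≡ pos ρ v p
    pos-keep ρ v p i = cong toℕ (update-keep w ρ v p i)

    isLetter′-sem : ∀ {Γ} (ρ : Env w Γ) a v p → Sat (isLetter′ a v p) ρ ⇔ (at w (pos ρ v p) ≡ a)
    isLetter′-sem ρ nothing  v p = mk⇔ (λ ¬⊤ → ⊥-elim (¬⊤ tt)) (λ at≡ _ → case-just (trans (sym (at-lookup w (ρ v p))) at≡))
      where case-just : ∀ {a : A} → just a ≡ nothing → ⊥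
            case-just ()
    isLetter′-sem ρ (just a) v p = mk⇔
      (λ eq → trans (at-lookup w (ρ v p)) (cong just eq))
      (λ at≡ → just-injective (trans (sym (at-lookup w (ρ v p))) at≡))

    betfac⇔OccursBetween : (S : List⁺ A) (i j : Fin (length w)) →
      betfac S w i j ⇔ OccursBetween w (toList S) (toℕ i) (toℕ j)
    betfac⇔OccursBetween S i j = mk⇔
      (λ { (s , i<s , fit , occ) → s , i<s , fit , from (OccursAt⇔take-drop w s (toList S)) occ })
      (λ { (s , i<s , fit , occ) → s , i<s , fit , to (OccursAt⇔take-drop w s (toList S)) occ })

    succ′-sem : ∀ {Γ} (ρ : Env w Γ) u v p q → Sat (succ′ u v p q) ρ ⇔ (suc (pos ρ u p) ≡ pos ρ v q)
    succ′-sem ρ u v p q = mk⇔ ⇒ ⇐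
      where
      x = pos ρ u p
      y = pos ρ v q
      letters⇔ = ⋁-sem betfac w ρ (map (λ a → binary (a ∷ []) u v {{p}} {{q}}) (allFin n))
      occurrence : (a : A) → Sat (binary (a ∷ []) u v {{p}} {{q}}) ρ ⇔ OccursBetween w (a ∷ []) x y
      occurrence a = betfac⇔OccursBetween (a ∷ []) (ρ u p) (ρ v q)
      ⇒ : Sat (succ′ u v p q) ρ → suc x ≡ y
      ⇒ (x<y , ¬letter) with m≤n⇒m<n∨m≡n x<y
      ... | inj₂ sx≡y = sx≡y
      ... | inj₁ sx<y with <⇒at≡just w (suc x) (<-trans sx<y (toℕ<n (ρ v q)))
      ...   | a , at≡ = ⊥-elim (¬letter (from letters⇔ λ ¬any → ¬any (map⁺ (lose (∈-allFin a) a-between))))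
        where
        a-between : Sat (binary (a ∷ []) u v {{p}} {{q}}) ρ
        a-between = from (occurrence a) (suc x , ≤-refl , subst (_≤ y) (+-comm 1 (suc x)) sx<y , at≡ , tt)
      ⇐ : suc x ≡ y → Sat (succ′ u v p q) ρ
      ⇐ sx≡y = subst (x <_) sx≡y ≤-refl , λ sat → to letters⇔ sat λ any →
        let a , _ , a-between = find (map⁻ any)
            s , x<s , fit , _ = to (occurrence a) a-between
        in <⇒≱ x<s (≤-pred (subst₂ _≤_ (+-comm s 1) (sym sx≡y) fit))

    sem-update : ∀ {Γ} (ρ : Env w Γ) v (φ : F (bind Γ v)) (Q : ℕ → Set) →
      (∀ ρ′ → Sat φ ρ′ ⇔ Q (pos ρ′ v (new v))) → ∀ i → Sat φ (update w ρ v i) ⇔ Q (toℕ i)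
    sem-update ρ v φ Q φ⇔ i = subst (λ m → Sat φ (update w ρ v i) ⇔ Q m) (pos-new ρ v i) (φ⇔ (update w ρ v i))

    next′-sem : ∀ {Γ} (ρ : Env w Γ) v p (φ : F (bind Γ (other v))) (Q : ℕ → Set) →
      (∀ ρ′ → Sat φ ρ′ ⇔ Q (pos ρ′ (other v) (new (other v)))) →
      Sat (next′ v p φ) ρ ⇔ (suc (pos ρ v p) < length w × Q (suc (pos ρ v p)))
    next′-sem ρ v p φ Q φ⇔ = mk⇔
      (λ { (i , succ , sat) → let i≡ = to (succ⇔ i) succ in
             subst (_< length w) (sym i≡) (toℕ<n i) , subst Q (sym i≡) (to (φ⇔′ i) sat) })
      (λ { (lt , q) → let i≡ = toℕ-fromℕ< lt in
             fromℕ< lt , from (succ⇔ (fromℕ< lt)) (sym i≡) , from (φ⇔′ (fromℕ< lt)) (subst Q (sym i≡) q) })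
      where
      φ⇔′ = sem-update ρ (other v) φ Q φ⇔
      succ⇔ : ∀ i → Sat (succ′ v (other v) (keep v p) (new (other v))) (update w ρ (other v) i) ⇔ (suc (pos ρ v p) ≡ toℕ i)
      succ⇔ i = subst₂ (λ a b → Sat (succ′ v (other v) (keep v p) (new (other v))) (update w ρ (other v) i) ⇔ (suc a ≡ b))
        (pos-keep ρ v p i) (pos-new ρ (other v) i)
        (succ′-sem (update w ρ (other v) i) v (other v) (keep v p) (new (other v)))

    prev′-sem : ∀ {Γ} (ρ : Env w Γ) v p (φ : F (bind Γ (other v))) (Q : ℕ → Set) →
      (∀ ρ′ → Sat φ ρ′ ⇔ Q (pos ρ′ (other v) (new (other v)))) →
      Sat (prev′ v p φ) ρ ⇔ (∃ λ j → suc j ≡ pos ρ v p × Q j)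
    prev′-sem ρ v p φ Q φ⇔ = mk⇔
      (λ { (i , succ , sat) → toℕ i , to (succ⇔ i) succ , to (φ⇔′ i) sat })
      (λ { (j , sj≡ , q) → let j<w = <-trans (≤-reflexive sj≡) (toℕ<n (ρ v p)) ; i≡ = toℕ-fromℕ< j<w in
             fromℕ< j<w , from (succ⇔ (fromℕ< j<w)) (trans (cong suc i≡) sj≡) , from (φ⇔′ (fromℕ< j<w)) (subst Q (sym i≡) q) })
      where
      φ⇔′ = sem-update ρ (other v) φ Q φ⇔
      succ⇔ : ∀ i → Sat (succ′ (other v) v (new (other v)) (keep v p)) (update w ρ (other v) i) ⇔ (suc (toℕ i) ≡ pos ρ v p)
      succ⇔ i = subst₂ (λ a b → Sat (succ′ (other v) v (new (other v)) (keep v p)) (update w ρ (other v) i) ⇔ (suc a ≡ b))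
        (pos-new ρ (other v) i) (pos-keep ρ v p i)
        (succ′-sem (update w ρ (other v) i) (other v) v (new (other v)) (keep v p))

    occursAfter′-sem : ∀ {Γ} S v p (ρ : Env w Γ) → Sat (occursAfter′ S v p) ρ ⇔ OccursAt w (suc (pos ρ v p)) S
    occursAfter′-sem []      v p ρ = mk⇔ (λ _ → tt) (λ _ → tt)
    occursAfter′-sem (a ∷ S) v p ρ = ⇔-trans
      (next′-sem ρ v p (isLetter′ (just a) (other v) (new (other v)) ∧′ occursAfter′ S (other v) (new (other v)))
        (λ y → at w y ≡ just a × OccursAt w (suc y) S)
        (λ ρ′ → isLetter′-sem ρ′ (just a) (other v) (new (other v)) ×-⇔ occursAfter′-sem S (other v) (new (other v)) ρ′))
      (mk⇔ proj₂ (λ occ → at≡just⇒< w _ (proj₁ occ) , occ))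

    allStars′-sem : ∀ {Γ} (ρ : Env w Γ) L → Sat (allStars′ L) ρ ⇔ All (_≡ nothing) L
    allStars′-sem ρ []            = mk⇔ (λ _ → []) (λ _ → tt)
    allStars′-sem ρ (nothing ∷ L) = mk⇔ ((refl ∷_) ∘ to (allStars′-sem ρ L)) (λ { (_ ∷ all) → from (allStars′-sem ρ L) all })
    allStars′-sem ρ (just a ∷ L)  = mk⇔ (λ ¬⊤ → ⊥-elim (¬⊤ tt)) (λ { (() ∷ _) })

    mutual
      backMatch′-sem : ∀ {Γ} L v p (ρ : Env w Γ) → Sat (backMatch′ L v p) ρ ⇔ BackMatch w (pos ρ v p) L
      backMatch′-sem []      v p ρ = mk⇔ (λ _ → tt) (λ _ → tt)
      backMatch′-sem (a ∷ L) v p ρ = isLetter′-sem ρ a v p ×-⇔ backMatchBefore′-sem L v p ρ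

      backMatchBefore′-sem : ∀ {Γ} L v p (ρ : Env w Γ) → Sat (backMatchBefore′ L v p) ρ ⇔ BackMatchBefore w (pos ρ v p) L
      backMatchBefore′-sem [] v p ρ with pos ρ v p
      ... | zero  = mk⇔ (λ _ → []) (λ _ → tt)
      ... | suc _ = mk⇔ (λ _ → tt) (λ _ → tt)
      backMatchBefore′-sem (nothing ∷ L) v p ρ with pos ρ v p in pos≡
      ... | zero  = mk⇔
        (λ { (_ , stars) → refl ∷ to (allStars′-sem ρ L) stars })
        (λ { (_ ∷ stars) → from (first′-sem betfac w ρ v p) pos≡ , from (allStars′-sem ρ L) stars })
      ... | suc j = mk⇔
        (λ { (first , _) → ⊥-elim (case-zero (trans (sym pos≡) (to (first′-sem betfac w ρ v p) first))) })
        (λ { (at≡ , _) → ⊥-elim (case-letter (<⇒at≡just w j (<-trans (≤-reflexive (sym pos≡)) (toℕ<n (ρ v p)))) at≡) })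
        where
        case-zero : suc j ≢ 0
        case-zero ()
        case-letter : (∃ λ a → at w j ≡ just a) → at w j ≢ nothing
        case-letter (a , at≡a) at≡ with () ← trans (sym at≡a) at≡
      backMatchBefore′-sem (just a ∷ L) v p ρ = ⇔-trans
        (prev′-sem ρ v p (backMatch′ (just a ∷ L) (other v) (new (other v))) (λ j → BackMatch w j (just a ∷ L))
          (backMatch′-sem (just a ∷ L) (other v) (new (other v))))
        (predecessor (pos ρ v p))
        where
        predecessor : ∀ m → (∃ λ j → suc j ≡ m × BackMatch w j (just a ∷ L)) ⇔ BackMatchBefore w m (just a ∷ L)
        predecessor zero    = mk⇔ (λ { (_ , () , _) }) (λ { (() ∷ _) })
        predecessor (suc m) = mk⇔ (λ { (_ , refl , bm) → bm }) (λ bm → m , refl , bm)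

    inside′-sem : ∀ {Γ} P S u v p q (ρ : Env w Γ) → Sat (inside′ P S u v p q) ρ ⇔ Inside w P S (pos ρ u p) (pos ρ v q)
    inside′-sem []      S u v p q ρ = betfac⇔OccursBetween S (ρ u p) (ρ v q)
    inside′-sem (a ∷ P) S u v p q ρ =
      backMatch′-sem (reverse (a ∷ P)) u p ρ ×-⇔ (occursAfter′-sem (toList S) u p ρ ×-⇔ betfac⇔OccursBetween S (ρ u p) (ρ v q))

    piece′-sem : ∀ {Γ} u v p q (ρ : Env w Γ) P R →
      Sat (piece′ u v p q (P , R)) ρ ⇔ (∃ λ S → R ≡ map just (toList S) × Inside w P S (pos ρ u p) (pos ρ v q))
    piece′-sem u v p q ρ P R with justs R in justs≡
    ... | just (s ∷ S) = mk⇔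
      (λ sat → (s ∷ S) , justs≡just⇒ R justs≡ , to (inside′-sem P (s ∷ S) u v p q ρ) sat)
      (λ { (S′ , R≡ , inside) → from (inside′-sem P (s ∷ S) u v p q ρ)
             (subst (λ S″ → Inside w P S″ (pos ρ u p) (pos ρ v q)) (unique S′ (trans (sym (justs-of R≡)) justs≡)) inside) })
      where
      unique : (S′ : List⁺ A) → just (toList S′) ≡ just (s ∷ S) → S′ ≡ s ∷ S
      unique (s′ ∷ S′) refl = refl
    ... | just [] = mk⇔ (λ ¬⊤ → ⊥-elim (¬⊤ tt))
      (λ { (S , R≡ , _) → ⊥-elim (case-[] S (trans (sym (justs-of R≡)) justs≡)) })
      where
      case-[] : (S : List⁺ A) → just (toList S) ≢ just []
      case-[] (_ ∷ _) ()
    ... | nothing = mk⇔ (λ ¬⊤ → ⊥-elim (¬⊤ tt))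
      (λ { (S , R≡ , _) → ⊥-elim (case-nothing (trans (sym (justs-of R≡)) justs≡)) })
      where
      case-nothing : ∀ {S : List A} → just S ≢ nothing
      case-nothing ()

    between′-sem : ∀ {Γ} L u v p q (ρ : Env w Γ) → 0 < length L →
      Sat (between′ L u v p q) ρ ⇔ (¬ ¬ Between w (reverse L) (pos ρ u p) (pos ρ v q))
    between′-sem L u v p q ρ L≢[] =
      ⇔-trans (⋁-sem betfac w ρ (map (piece′ u v p q) (splits L))) (mk⇔ (¬¬-map sound) (¬¬-map complete))
      where
      x = pos ρ u p
      y = pos ρ v q
      sound : Any (λ φ → Sat φ ρ) (map (piece′ u v p q) (splits L)) → Between w (reverse L) x y
      sound any with find (map⁻ any)
      ... | (P , R) , mem , sat with to (piece′-sem u v p q ρ P R) sat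
      ...   | S , refl , inside = subst (λ L′ → Between w (reverse L′) x y) (∈-splits⁻ L mem) (Inside⇒Between w P S inside)
      complete : Between w (reverse L) x y → Any (λ φ → Sat φ ρ) (map (piece′ u v p q) (splits L))
      complete btw with Between⇒Inside w L x y L≢[] (toℕ<n (ρ v q)) btw
      ... | P , S , refl , inside =
        map⁺ (lose (∈-splits⁺ P (map just (toList S))) (from (piece′-sem u v p q ρ P (map just (toList S))) (S , refl , inside)))

module Translation (n k : ℕ) where

  open Formulas n

  private
    A : Set
    A = Fin n
    C : Set
    C = Ext A (suc k)

  translate : ∀ {Γ} → Fm C C Γ → F Γ
  translate true′                        = true′
  translate (_<′_ u v {{p}} {{q}})       = _<′_ u v {{p}} {{q}}
  translate (_=′_ u v {{p}} {{q}})       = _=′_ u v {{p}} {{q}}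
  translate (letter c v {{p}})           = backMatch′ (reverse (Vec.toList c)) v p
  translate (binary c u v {{p}} {{q}})   = between′ (Vec.toList c) u v p q
  translate (¬′ φ)                       = ¬′ translate φ
  translate (φ ∧′ ψ)                     = translate φ ∧′ translate ψ
  translate (∃′ v φ)                     = ∃′ v (translate φ)

  module Correctness (w : List A) where

    open Semantics w
    open Padded k w

    Agree : ∀ {Γ} → Env w Γ → Env w″ Γ → Set
    Agree {Γ} ρ ρ″ = ∀ v (p : T (Γ v)) → toℕ (ρ v p) ≡ toℕ (ρ″ v p)

    Agree-update : ∀ {Γ} {ρ : Env w Γ} {ρ″ : Env w″ Γ} → Agree ρ ρ″ →
      ∀ v i i″ → toℕ i ≡ toℕ i″ → Agree (update w ρ v i) (update w″ ρ″ v i″)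
    Agree-update agree vx i i″ i≡ vx p = i≡
    Agree-update agree vx i i″ i≡ vy p = agree vy p
    Agree-update agree vy i i″ i≡ vx p = agree vx p
    Agree-update agree vy i i″ i≡ vy p = i≡

    bet? : (c : C) (i j : Fin (length w″)) → Dec (bet c w″ i j)
    bet? c i j = any? λ z → (toℕ i <? toℕ z) ×-dec (toℕ z <? toℕ j) ×-dec Vec.≡-dec (Maybeₚ.≡-dec Fin._≟_) (lookup w″ z) c

    backMatch′⇔lookup : ∀ {Γ} (c : C) v p (ρ : Env w Γ) (ρ″ : Env w″ Γ) → Agree ρ ρ″ →
      Sat (backMatch′ (reverse (Vec.toList c)) v p) ρ ⇔ (lookup w″ (ρ″ v p) ≡ c)
    backMatch′⇔lookup c v p ρ ρ″ agree = ⇔-trans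
      (backMatch′-sem (reverse (Vec.toList c)) v p ρ)
      (subst (λ m → BackMatch w m (reverse (Vec.toList c)) ⇔ (lookup w″ (ρ″ v p) ≡ c)) (sym (agree v p))
        (⇔-sym (lookup-w″≡⇔BackMatch (ρ″ v p) c)))

    -- ⋁ is built from ¬′ and ∧′, so it only yields ¬ ¬ Between; decidability of bet removes the ¬ ¬.
    between′⇔bet : ∀ {Γ} (c : C) u v p q (ρ : Env w Γ) (ρ″ : Env w″ Γ) → Agree ρ ρ″ →
      Sat (between′ (Vec.toList c) u v p q) ρ ⇔ bet c w″ (ρ″ u p) (ρ″ v q)
    between′⇔bet c u v p q ρ ρ″ agree = mk⇔
      (λ sat → decidable-stable (bet? c (ρ″ u p) (ρ″ v q)) (¬¬-map (from bet⇔ ∘ agreeing) (to between⇔ sat)))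
      (λ b → from between⇔ λ ¬btw → ¬btw (subst₂ (Between w L) (sym (agree u p)) (sym (agree v q)) (to bet⇔ b)))
      where
      L = reverse (Vec.toList c)
      bet⇔ = bet⇔Between c (ρ″ u p) (ρ″ v q)
      between⇔ = between′-sem (Vec.toList c) u v p q ρ (subst (0 <_) (sym (Vec.length-toList c)) z<s)
      agreeing : Between w L (pos ρ u p) (pos ρ v q) → Between w L (toℕ (ρ″ u p)) (toℕ (ρ″ v q))
      agreeing = subst₂ (Between w L) (agree u p) (agree v q)

    translate-correct : ∀ {Γ} (φ : Fm C C Γ) (ρ : Env w Γ) (ρ″ : Env w″ Γ) → Agree ρ ρ″ →
      Sat (translate φ) ρ ⇔ ⟦ φ ⟧ bet w″ ρ″
    translate-correct true′ ρ ρ″ agree = mk⇔ id id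
    translate-correct (_<′_ u v {{p}} {{q}}) ρ ρ″ agree =
      mk⇔ (subst₂ _<_ (agree u p) (agree v q)) (subst₂ _<_ (sym (agree u p)) (sym (agree v q)))
    translate-correct (_=′_ u v {{p}} {{q}}) ρ ρ″ agree = mk⇔
      (λ eq → toℕ-injective (trans (sym (agree u p)) (trans (cong toℕ eq) (agree v q))))
      (λ eq → toℕ-injective (trans (agree u p) (trans (cong toℕ eq) (sym (agree v q)))))
    translate-correct (letter c v {{p}}) ρ ρ″ agree = backMatch′⇔lookup c v p ρ ρ″ agree
    translate-correct (binary c u v {{p}} {{q}}) ρ ρ″ agree = between′⇔bet c u v p q ρ ρ″ agree
    translate-correct (¬′ φ) ρ ρ″ agree = ¬-cong-⇔ (translate-correct φ ρ ρ″ agree)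
    translate-correct (φ ∧′ ψ) ρ ρ″ agree = translate-correct φ ρ ρ″ agree ×-⇔ translate-correct ψ ρ ρ″ agree
    translate-correct (∃′ v φ) ρ ρ″ agree = mk⇔
      (λ { (i , sat) → cast (sym length-w″) i ,
             to (translate-correct φ _ _ (Agree-update agree v i _ (sym (toℕ-cast (sym length-w″) i)))) sat })
      (λ { (i″ , sat) → cast length-w″ i″ ,
             from (translate-correct φ _ _ (Agree-update agree v _ i″ (toℕ-cast length-w″ i″))) sat })

proposition8p4 : (n : ℕ) (k : ℕ) → 1 < k →
    (φ′ : FO2bet (Ext (Fin n) k)) →
    Σ (FO2betfac (Fin n)) λ φ →
      (w : List (Fin n)) → w ≢ [] → k ∸ 1 ≤ length w →
      (w ⊨[ betfac ] φ) ⇔ ((_″ {k = k} w) ⊨[ bet ] φ′)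
proposition8p4 n (suc k) _ φ′ =
  translate φ′ , λ w _ _ → translate-correct w φ′ (emptyEnv w) (emptyEnv (_″ {k = suc k} w)) (λ v ())
  where open Translation n k using (translate; module Correctness)
        open Correctness using (translate-correct)
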